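{- Let $M$ be a finite matroid and let $\mathcal{C} = \{F_i : i \in I\}$ be a finite collection (multiset) of flats of $M$ with $|\mathcal{C}| > 1$. Then there exists a collection (multiset) of flats $\mathcal{C}'$ of $M$ such that $|\mathcal{C}'| = |\mathcal{C}|$, $\Delta(\mathcal{C}') \geq \Delta(\mathcal{C})$, and for every $F \in \mathcal{C}'$ we have $F \subseteq cl\left(\bigcup(\mathcal{C}' \setminus \{F\})\right)$.
   Context: $M$ has ground set $N$ and rank function $r$; a flat is a set $F$ with $r(F\cup\{n\})>r(F)$ for all $n\in N\setminus F$, and $cl(A)$ is the smallest flat containing $A$. For a collection $\mathcal{C} = \{F_i : i \in I\}$ of flats (repetitions allowed, counted in $|\mathcal{C}|$), put $F_S = \bigcap_{i\in S} F_i$ for $\emptyset \neq S \subseteq I$ and $F_\emptyset = \bigcup_{i\in I} F_i$, and $\Delta(\mathcal{C}) = \sum_{S \subseteq I} (-1)^{|S|} r(F_S)$. Here $\mathcal{C}'\setminus\{F\}$ denotes the collection with (one occurrence of) the member $F$ removed. -}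

module Defs where

open import Data.Nat using (ℕ; zero; suc; _+_; _≤_; _<_)
open import Data.Integer as ℤ using (ℤ; +_; -_)
open import Data.Bool using (Bool; true; false)
open import Data.Fin using (Fin; _≟_)
open import Data.Fin.Subset using (Subset; _∈_; _∉_; _⊆_; _∩_; _∪_; ⁅_⁆; ∣_∣; ⊤; ⊥; inside; outside)
open import Data.Vec using (Vec; []; _∷_; lookup)
open import Data.List using (List; []; _∷_; map; _++_; foldr)
open import Data.List.Membership.Propositional using () renaming (_∈_ to _∈ₗ_)
open import Data.Product using (Σ; _×_; _,_)
open import Relation.Nullary using (¬_; yes; no)

record Matroid (n : ℕ) : Set where
  field
    r         : Subset n → ℕ
    r-bounded : ∀ A → r A ≤ ∣ A ∣
    r-mono    : ∀ {A B} → A ⊆ B → r A ≤ r B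
    r-submod  : ∀ A B → r (A ∪ B) + r (A ∩ B) ≤ r A + r B
open Matroid public

module _ {n : ℕ} (M : Matroid n) where

  IsFlat : Subset n → Set
  IsFlat F = ∀ x → x ∉ F → r M F < r M (F ∪ ⁅ x ⁆)

  IsClosure : Subset n → Subset n → Set
  IsClosure A C = IsFlat C × A ⊆ C × (∀ G → IsFlat G → A ⊆ G → C ⊆ G)

allSubsets : ∀ k → List (Subset k)
allSubsets zero = [] ∷ []
allSubsets (suc k) = map (outside ∷_) (allSubsets k) ++ map (inside ∷_) (allSubsets k)

allFin : ∀ k → List (Fin k)
allFin k = Data.List.allFin k

module _ {n k : ℕ} (F : Fin k → Subset n) where

  unionAll : Subset n
  unionAll = foldr (λ i acc → F i ∪ acc) ⊥ (allFin k)

  interOver : Subset k → Subset n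
  interOver S = foldr (λ i acc → step i (lookup S i) acc) ⊤ (allFin k)
    where
    step : Fin k → Bool → Subset n → Subset n
    step i true  acc = F i ∩ acc
    step i false acc = acc

  -- F_S, with the convention F_∅ = ⋃_{i ∈ I} F_i
  F[_] : Subset k → Subset n
  F[ S ] with ∣ S ∣
  ... | zero  = unionAll
  ... | suc _ = interOver S

  unionExcept : Fin k → Subset n
  unionExcept j = foldr (λ i acc → step i acc) ⊥ (allFin k)
    where
    step : Fin k → Subset n → Subset n
    step i acc with i ≟ j
    ... | yes _ = acc
    ... | no  _ = F i ∪ acc

sign : ℕ → ℤ
sign zero = + 1
sign (suc m) = - sign m

Δ : ∀ {n k} → Matroid n → (Fin k → Subset n) → ℤ
Δ M F = foldr (λ S acc → sign ∣ S ∣ ℤ.* (+ r M (F[ F ] S)) ℤ.+ acc) (+ 0) (allSubsets _)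

module Submission where

-- If some F_j is not contained in the closure K of the union U of the other
-- members, replace it by the flat F_j ∩ K.  Every F_S with j ∈ S ≠ {j} already
-- lies in some F_i ⊆ U ⊆ K, so only the terms S = ∅ and S = {j} of Δ change,
-- and Δ does not decrease by submodularity:
--   r(⋃C) + r(F_j ∩ K) ≤ r(K ∪ F_j) + r(K ∩ F_j) ≤ r(K) + r(F_j) = r(U) + r(F_j)
--                      ≤ r(⋃C′) + r(F_j).
-- Each step strictly shrinks Σ |F_i|, so after finitely many steps every member
-- lies in the closure of the others.

open import Defs
open import Data.Nat as ℕ using (ℕ; zero; suc; _≤_; _<_; z≤n; s≤s⁻¹)
import Data.Nat.Properties as ℕP
open import Data.Integer as ℤ using (ℤ; +_; -_; _+_; _-_; _*_; _≥_)
import Data.Integer.Properties as ℤP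
open import Data.Integer.Tactic.RingSolver using (solve-∀)
open import Data.Bool using (true; false; T)
import Data.Bool as Bool
open import Data.Fin using (Fin; zero; suc; _≟_)
open import Data.Fin.Properties using (any?; all?; ¬∀⟶∃¬)
open import Data.Fin.Subset
  using (Subset; _∈_; _∉_; _⊆_; _⊂_; _∪_; _∩_; ⁅_⁆; ∣_∣; ⊥; ⊤; inside; outside)
open import Data.Fin.Subset.Properties
  using ( x∈p∪q⁺; x∈p∪q⁻; x∈p∩q⁺; x∈p∩q⁻; p⊆p∪q; q⊆p∪q; p∩q⊆p; p∩q⊆q; ∩-comm
        ; ∉⊥; ∈⊤; x∈⁅x⁆; x∈⁅y⁆⇒x≡y; ∣⊥∣≡0; ∣⁅x⁆∣≡1; Empty-unique; ⊆-min; ⊆-antisym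
        ; p⊆q⇒∣p∣≤∣q∣; p⊂q⇒∣p∣<∣q∣; _∈?_; _⊆?_ )
open import Data.Vec using ([]; _∷_; lookup; tabulate)
open import Data.Vec.Properties using ([]=⇒lookup; lookup⇒[]=; lookup∘tabulate; ∷-injectiveʳ; ≡-dec)
open import Data.Vec.Functional using (updateAt)
open import Data.Vec.Functional.Properties using (updateAt-updates; updateAt-minimal)
open import Data.List using (List; []; _∷_; foldr; map; _++_)
import Data.List as List
open import Data.List.Properties using (foldr-map)
open import Data.List.Membership.Propositional using () renaming (_∈_ to _∈ₗ_)
open import Data.List.Membership.Propositional.Properties using (∈-allFin; ∈-filter⁺)
open import Data.List.Relation.Unary.All using (All; []; _∷_)
open import Data.List.Relation.Unary.Any using (Any; here; there)
import Data.List.Relation.Unary.All.Properties as All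
import Data.List.Relation.Unary.Any.Properties as Any
open import Data.Product using (Σ; ∃; _×_; _,_; proj₁; proj₂)
open import Data.Sum using (_⊎_; inj₁; inj₂; [_,_]′) renaming (map to ⊎-map)
open import Data.Empty using (⊥-elim)
open import Function using (_∘_; id)
open import Relation.Nullary using (¬_; Dec; yes; no; does; contradiction)
open import Relation.Nullary.Decidable using (_×-dec_; ¬?; decidable-stable; dec-true; dec-false)
open import Relation.Binary.PropositionalEquality
  using (_≡_; _≢_; refl; sym; trans; cong; cong₂; subst; module ≡-Reasoning)

private
  variable
    n k : ℕ
    p p′ q q′ : Subset n

∪-mono : p ⊆ p′ → q ⊆ q′ → p ∪ q ⊆ p′ ∪ q′
∪-mono p⊆p′ q⊆q′ x∈p∪q = x∈p∪q⁺ (⊎-map p⊆p′ q⊆q′ (x∈p∪q⁻ _ _ x∈p∪q))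

⊈⇒∃∉ : ¬ (p ⊆ q) → ∃ λ x → x ∈ p × x ∉ q
⊈⇒∃∉ {p = p} {q = q} p⊈q with any? (λ x → x ∈? p ×-dec ¬? (x ∈? q))
... | yes witness = witness
... | no none = ⊥-elim (p⊈q λ {x} x∈p → decidable-stable (x ∈? q) λ x∉q → none (x , x∈p , x∉q))

∣p∣≡0⇒p≡⊥ : ∀ {n} {p : Subset n} → ∣ p ∣ ≡ 0 → p ≡ ⊥
∣p∣≡0⇒p≡⊥ {n = n} {p = p} ∣p∣≡0 = Empty-unique λ (x , x∈p) →
  ℕP.n≮0 (subst (∣ ⊥ {n = n} ∣ <_) ∣p∣≡0 (p⊂q⇒∣p∣<∣q∣ (⊆-min p , x , x∈p , ∉⊥)))

⁅⁆⊆ : ∀ {x} → x ∈ p → ⁅ x ⁆ ⊆ p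
⁅⁆⊆ {x = x} x∈p y∈⁅x⁆ = subst (_∈ _) (sym (x∈⁅y⁆⇒x≡y x y∈⁅x⁆)) x∈p

⁅⁆≢⊥ : (x : Fin n) → ⁅ x ⁆ ≢ ⊥
⁅⁆≢⊥ x ⁅x⁆≡⊥ = ∉⊥ (subst (x ∈_) ⁅x⁆≡⊥ (x∈⁅x⁆ x))

∈∧≢⁅⁆⇒∃≢ : ∀ {S : Subset n} {x} → x ∈ S → S ≢ ⁅ x ⁆ → ∃ λ y → y ∈ S × y ≢ x
∈∧≢⁅⁆⇒∃≢ {S = S} {x} x∈S S≢⁅x⁆ with any? (λ y → y ∈? S ×-dec ¬? (y ≟ x))
... | yes witness = witness
... | no none = contradiction (⊆-antisym S⊆⁅x⁆ (⁅⁆⊆ x∈S)) S≢⁅x⁆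
  where
  S⊆⁅x⁆ : S ⊆ ⁅ x ⁆
  S⊆⁅x⁆ {y} y∈S =
    subst (_∈ ⁅ x ⁆) (sym (decidable-stable (y ≟ x) λ y≢x → none (y , y∈S , y≢x))) (x∈⁅x⁆ x)

updateAt-elim : ∀ {A : Set} (P : Fin k → A → Set) (xs : Fin k → A) j {f : A → A}
              → P j (f (xs j)) → (∀ i → i ≢ j → P i (xs i)) → ∀ i → P i (updateAt xs j f i)
updateAt-elim P xs j Pj Pi i with i ≟ j
... | yes refl = subst (P j) (sym (updateAt-updates j xs)) Pj
... | no  i≢j  = subst (P i) (sym (updateAt-minimal i j xs i≢j)) (Pi i i≢j)

module _ {A : Set} (step : A → Subset n → Subset n) {P : A → Fin n → Set} where

  ∈-foldr-∪⁻ : (∀ a acc {x} → x ∈ step a acc → P a x ⊎ x ∈ acc)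
             → ∀ as {x} → x ∈ foldr step ⊥ as → Any (λ a → P a x) as
  ∈-foldr-∪⁻ step⁻ []       x∈ = ⊥-elim (∉⊥ x∈)
  ∈-foldr-∪⁻ step⁻ (a ∷ as) x∈ = [ here , there ∘ ∈-foldr-∪⁻ step⁻ as ]′ (step⁻ a _ x∈)

  ∈-foldr-∪⁺ : (∀ a acc {x} → P a x ⊎ x ∈ acc → x ∈ step a acc)
             → ∀ as {x} → Any (λ a → P a x) as → x ∈ foldr step ⊥ as
  ∈-foldr-∪⁺ step⁺ (a ∷ as) (here  pa)  = step⁺ a _ (inj₁ pa)
  ∈-foldr-∪⁺ step⁺ (a ∷ as) (there any) = step⁺ a _ (inj₂ (∈-foldr-∪⁺ step⁺ as any))

  ∈-foldr-∩⁻ : (∀ a acc {x} → x ∈ step a acc → P a x × x ∈ acc)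
             → ∀ as {x} → x ∈ foldr step ⊤ as → All (λ a → P a x) as
  ∈-foldr-∩⁻ step⁻ []       x∈ = []
  ∈-foldr-∩⁻ step⁻ (a ∷ as) x∈ with step⁻ a _ x∈
  ... | pa , x∈acc = pa ∷ ∈-foldr-∩⁻ step⁻ as x∈acc

  ∈-foldr-∩⁺ : (∀ a acc {x} → P a x → x ∈ acc → x ∈ step a acc)
             → ∀ as {x} → All (λ a → P a x) as → x ∈ foldr step ⊤ as
  ∈-foldr-∩⁺ step⁺ []       []          = ∈⊤
  ∈-foldr-∩⁺ step⁺ (a ∷ as) (pa ∷ all) = step⁺ a _ pa (∈-foldr-∩⁺ step⁺ as all)

module _ {n k} (F : Fin k → Subset n) where

  ∈-unionAll⁻ : ∀ {x} → x ∈ unionAll F → ∃ λ i → x ∈ F i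
  ∈-unionAll⁻ = Any.tabulate⁻ ∘ ∈-foldr-∪⁻ _ (λ i acc → x∈p∪q⁻ (F i) acc) (List.allFin k)

  ∈-unionAll⁺ : ∀ {i x} → x ∈ F i → x ∈ unionAll F
  ∈-unionAll⁺ {i} = ∈-foldr-∪⁺ _ (λ _ _ → x∈p∪q⁺) (List.allFin k) ∘ Any.tabulate⁺ i

  module _ (j : Fin k) where

    -- The step function of the fold defining unionExcept is local to Defs;
    -- it is recovered here by unification.
    private
      exceptFold : Σ (Fin k → Subset n → Subset n) λ step → unionExcept F j ≡ foldr step ⊥ (allFin k)
      exceptFold = _ , refl

      step = proj₁ exceptFold

      step⁻ : ∀ i acc {x} → x ∈ step i acc → (i ≢ j × x ∈ F i) ⊎ x ∈ acc
      step⁻ i acc x∈ with i ≟ j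
      ... | yes _   = inj₂ x∈
      ... | no  i≢j = ⊎-map (i≢j ,_) id (x∈p∪q⁻ (F i) acc x∈)

      step⁺ : ∀ i acc {x} → (i ≢ j × x ∈ F i) ⊎ x ∈ acc → x ∈ step i acc
      step⁺ i acc x∈ with i ≟ j
      step⁺ i acc (inj₁ (i≢j , _)) | yes i≡j = contradiction i≡j i≢j
      step⁺ i acc (inj₂ x∈acc)     | yes _   = x∈acc
      step⁺ i acc x∈               | no  _   = x∈p∪q⁺ (⊎-map proj₂ id x∈)

    ∈-unionExcept⁻ : ∀ {x} → x ∈ unionExcept F j → ∃ λ i → i ≢ j × x ∈ F i
    ∈-unionExcept⁻ = Any.tabulate⁻ ∘ ∈-foldr-∪⁻ step step⁻ (List.allFin k)

    ∈-unionExcept⁺ : ∀ {i x} → i ≢ j → x ∈ F i → x ∈ unionExcept F j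
    ∈-unionExcept⁺ {i} i≢j x∈ =
      ∈-foldr-∪⁺ step step⁺ (List.allFin k) (Any.tabulate⁺ i (i≢j , x∈))

    unionAll⊆unionExcept∪ : unionAll F ⊆ unionExcept F j ∪ F j
    unionAll⊆unionExcept∪ x∈ with ∈-unionAll⁻ x∈
    ... | i , x∈Fi with i ≟ j
    ...   | yes refl = q⊆p∪q _ (F j) x∈Fi
    ...   | no  i≢j  = p⊆p∪q (F j) (∈-unionExcept⁺ i≢j x∈Fi)

  module _ (S : Subset k) where

    private
      interFold : Σ (Fin k → Subset n → Subset n) λ step → interOver F S ≡ foldr step ⊤ (allFin k)
      interFold = _ , refl

      step = proj₁ interFold

      step⁻ : ∀ i acc {x} → x ∈ step i acc → (i ∈ S → x ∈ F i) × x ∈ acc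
      step⁻ i acc x∈ with lookup S i in S[i]
      ... | true  = (λ _ → proj₁ (x∈p∩q⁻ (F i) acc x∈)) , proj₂ (x∈p∩q⁻ (F i) acc x∈)
      ... | false = (λ i∈S → contradiction (trans (sym ([]=⇒lookup i∈S)) S[i]) λ ()) , x∈

      step⁺ : ∀ i acc {x} → (i ∈ S → x ∈ F i) → x ∈ acc → x ∈ step i acc
      step⁺ i acc x∈F x∈acc with lookup S i in S[i]
      ... | true  = x∈p∩q⁺ (x∈F (lookup⇒[]= i S S[i]) , x∈acc)
      ... | false = x∈acc

    ∈-interOver⁻ : ∀ {x i} → x ∈ interOver F S → i ∈ S → x ∈ F i
    ∈-interOver⁻ {i = i} x∈ = All.tabulate⁻ (∈-foldr-∩⁻ step step⁻ (List.allFin k) x∈) i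

    ∈-interOver⁺ : ∀ {x} → (∀ {i} → i ∈ S → x ∈ F i) → x ∈ interOver F S
    ∈-interOver⁺ x∈F = ∈-foldr-∩⁺ step step⁺ (List.allFin k) (All.tabulate⁺ λ i → x∈F)

totalSize : (Fin k → Subset n) → ℕ
totalSize {k = zero}  C = 0
totalSize {k = suc k} C = ∣ C zero ∣ ℕ.+ totalSize (C ∘ suc)

totalSize-mono : {C D : Fin k → Subset n} → (∀ i → D i ⊆ C i) → totalSize D ≤ totalSize C
totalSize-mono {k = zero}  D⊆C = z≤n
totalSize-mono {k = suc k} D⊆C =
  ℕP.+-mono-≤ (p⊆q⇒∣p∣≤∣q∣ (D⊆C zero)) (totalSize-mono (D⊆C ∘ suc))

totalSize-strict : {C D : Fin k → Subset n} {j : Fin k} → (∀ i → D i ⊆ C i) → D j ⊂ C j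
                 → totalSize D < totalSize C
totalSize-strict {j = zero}  D⊆C Dj⊂Cj =
  ℕP.+-mono-<-≤ (p⊂q⇒∣p∣<∣q∣ Dj⊂Cj) (totalSize-mono (D⊆C ∘ suc))
totalSize-strict {j = suc j} D⊆C Dj⊂Cj =
  ℕP.+-mono-≤-< (p⊆q⇒∣p∣≤∣q∣ (D⊆C zero)) (totalSize-strict (D⊆C ∘ suc) Dj⊂Cj)

module Closure {n} (M : Matroid n) where

  private
    variable
      A B F G : Subset n
      x : Fin n

  Spanned : Subset n → Fin n → Set
  Spanned A x = r M (A ∪ ⁅ x ⁆) ≤ r M A

  spanned? : ∀ A x → Dec (Spanned A x)
  spanned? A x = r M (A ∪ ⁅ x ⁆) ℕ.≤? r M A

  ∈⇒spanned : x ∈ A → Spanned A x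
  ∈⇒spanned {x} {A} x∈A = r-mono M λ y∈ → [ id , ⁅⁆⊆ x∈A ]′ (x∈p∪q⁻ A ⁅ x ⁆ y∈)

  spanned-mono : A ⊆ B → Spanned A x → Spanned B x
  spanned-mono {A} {B} {x} A⊆B A-spans-x = ℕP.+-cancelʳ-≤ (r M A) _ _ (begin
    r M (B ∪ ⁅ x ⁆) ℕ.+ r M A
      ≤⟨ ℕP.+-mono-≤ (r-mono M (∪-mono id (q⊆p∪q A ⁅ x ⁆)))
                     (r-mono M λ y∈A → x∈p∩q⁺ (A⊆B y∈A , p⊆p∪q ⁅ x ⁆ y∈A)) ⟩
    r M (B ∪ (A ∪ ⁅ x ⁆)) ℕ.+ r M (B ∩ (A ∪ ⁅ x ⁆))
      ≤⟨ r-submod M B (A ∪ ⁅ x ⁆) ⟩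
    r M B ℕ.+ r M (A ∪ ⁅ x ⁆)
      ≤⟨ ℕP.+-monoʳ-≤ (r M B) A-spans-x ⟩
    r M B ℕ.+ r M A ∎)
    where open ℕP.≤-Reasoning

  flat⇒¬spanned : IsFlat M F → B ⊆ F → x ∉ F → ¬ Spanned B x
  flat⇒¬spanned {F} {B} {x} F-flat B⊆F x∉F = ℕP.<⇒≱ (F-flat x x∉F) ∘ spanned-mono B⊆F

  ∩-isFlat : IsFlat M F → IsFlat M G → IsFlat M (F ∩ G)
  ∩-isFlat {F} {G} F-flat G-flat x x∉F∩G with x ∈? F | x ∈? G
  ... | no  x∉F | _       = ℕP.≰⇒> (flat⇒¬spanned F-flat (p∩q⊆p F G) x∉F)
  ... | yes _   | no  x∉G = ℕP.≰⇒> (flat⇒¬spanned G-flat (p∩q⊆q F G) x∉G)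
  ... | yes x∈F | yes x∈G = contradiction (x∈p∩q⁺ (x∈F , x∈G)) x∉F∩G

  cl : Subset n → Subset n
  cl A = tabulate λ x → does (spanned? A x)

  ∈-cl⁺ : Spanned A x → x ∈ cl A
  ∈-cl⁺ {A} {x} A-spans-x =
    lookup⇒[]= x (cl A) (trans (lookup∘tabulate _ x) (dec-true (spanned? A x) A-spans-x))

  ∈-cl⁻ : x ∈ cl A → Spanned A x
  ∈-cl⁻ {x} {A} x∈cl = decidable-stable (spanned? A x) λ ¬spans →
    subst T (trans (sym ([]=⇒lookup x∈cl)) (trans (lookup∘tabulate _ x) (dec-false (spanned? A x) ¬spans))) _

  ⊆-cl : A ⊆ cl A
  ⊆-cl = ∈-cl⁺ ∘ ∈⇒spanned

  cl-least : IsFlat M G → A ⊆ G → cl A ⊆ G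
  cl-least {G} G-flat A⊆G {x} x∈cl =
    decidable-stable (x ∈? G) λ x∉G → flat⇒¬spanned G-flat A⊆G x∉G (∈-cl⁻ x∈cl)

  insertAll : Subset n → List (Fin n) → Subset n
  insertAll = foldr λ x B → B ∪ ⁅ x ⁆

  ⊆-insertAll : ∀ xs → A ⊆ insertAll A xs
  ⊆-insertAll []       = id
  ⊆-insertAll (x ∷ xs) = p⊆p∪q ⁅ x ⁆ ∘ ⊆-insertAll xs

  ∈-insertAll : ∀ {xs} → x ∈ₗ xs → x ∈ insertAll A xs
  ∈-insertAll {x} (here refl)  = q⊆p∪q _ ⁅ x ⁆ (x∈⁅x⁆ x)
  ∈-insertAll     (there x∈xs) = p⊆p∪q _ (∈-insertAll x∈xs)

  insertAll-spanned : ∀ {xs} → All (Spanned A) xs → r M (insertAll A xs) ≤ r M A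
  insertAll-spanned []                    = ℕP.≤-refl
  insertAll-spanned {xs = x ∷ xs} (A-spans-x ∷ A-spans-xs) =
    ℕP.≤-trans (spanned-mono (⊆-insertAll xs) A-spans-x) (insertAll-spanned A-spans-xs)

  cl-rank : r M (cl A) ≤ r M A
  cl-rank {A} = ℕP.≤-trans
    (r-mono M λ {x} x∈cl → ∈-insertAll (∈-filter⁺ (spanned? A) (∈-allFin x) (∈-cl⁻ x∈cl)))
    (insertAll-spanned (All.all-filter (spanned? A) (List.allFin n)))

  cl-isFlat : IsFlat M (cl A)
  cl-isFlat {A} x x∉cl = ℕP.≤-<-trans cl-rank
    (ℕP.<-≤-trans (ℕP.≰⇒> (x∉cl ∘ ∈-cl⁺)) (r-mono M (∪-mono ⊆-cl id)))

  cl-isClosure : IsClosure M A (cl A)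
  cl-isClosure = cl-isFlat , ⊆-cl , λ G G-flat A⊆G → cl-least G-flat A⊆G

_≟ˢ_ : (S T : Subset k) → Dec (S ≡ T)
_≟ˢ_ = ≡-dec Bool._≟_

sumOver : ∀ {A : Set} → (A → ℤ) → List A → ℤ
sumOver f = foldr (λ a acc → f a + acc) (+ 0)

sumOver-++ : ∀ {A : Set} (f : A → ℤ) as bs → sumOver f (as ++ bs) ≡ sumOver f as + sumOver f bs
sumOver-++ f []       bs = sym (ℤP.+-identityˡ _)
sumOver-++ f (a ∷ as) bs = trans (cong (λ s → f a + s) (sumOver-++ f as bs)) (sym (ℤP.+-assoc (f a) _ _))

sumOver-cong : ∀ {A : Set} {f g : A → ℤ} → (∀ a → f a ≡ g a) → ∀ as → sumOver f as ≡ sumOver g as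
sumOver-cong f≗g []       = refl
sumOver-cong f≗g (a ∷ as) = cong₂ _+_ (f≗g a) (sumOver-cong f≗g as)

sumSubsets : (Subset k → ℤ) → ℤ
sumSubsets {k} f = sumOver f (allSubsets k)

sumSubsets-suc : (f : Subset (suc k) → ℤ)
               → sumSubsets f ≡ sumSubsets (f ∘ (outside ∷_)) + sumSubsets (f ∘ (inside ∷_))
sumSubsets-suc {k} f = trans (sumOver-++ f (map (outside ∷_) (allSubsets k)) _)
  (cong₂ _+_ (foldr-map _ (outside ∷_) (+ 0) (allSubsets k)) (foldr-map _ (inside ∷_) (+ 0) (allSubsets k)))

sumSubsets-update : (f g : Subset k → ℤ) (T : Subset k) → (∀ S → S ≢ T → f S ≡ g S)
                  → sumSubsets f ≡ sumSubsets g + (f T - g T)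
sumSubsets-update {zero}  f g [] _ = lemma (f []) (g [])
  where
  lemma : ∀ a b → a + + 0 ≡ (b + + 0) + (a - b)
  lemma = solve-∀
sumSubsets-update {suc k} f g (outside ∷ T) f≗g = begin
  sumSubsets f                                                 ≡⟨ sumSubsets-suc f ⟩
  sumSubsets (f ∘ (outside ∷_)) + sumSubsets (f ∘ (inside ∷_))
    ≡⟨ cong₂ _+_ (sumSubsets-update _ _ T λ S S≢T → f≗g _ (S≢T ∘ ∷-injectiveʳ))
                 (sumOver-cong (λ S → f≗g (inside ∷ S) λ ()) (allSubsets k)) ⟩
  (sumSubsets (g ∘ (outside ∷_)) + d) + sumSubsets (g ∘ (inside ∷_))
    ≡⟨ +-right-comm (sumSubsets (g ∘ (outside ∷_))) d _ ⟩
  (sumSubsets (g ∘ (outside ∷_)) + sumSubsets (g ∘ (inside ∷_))) + d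
    ≡⟨ cong (_+ d) (sym (sumSubsets-suc g)) ⟩
  sumSubsets g + d                                             ∎
  where
  open ≡-Reasoning
  d : ℤ
  d = f (outside ∷ T) - g (outside ∷ T)
  +-right-comm : ∀ a b c → (a + b) + c ≡ (a + c) + b
  +-right-comm = solve-∀
sumSubsets-update {suc k} f g (inside ∷ T) f≗g = begin
  sumSubsets f                                                 ≡⟨ sumSubsets-suc f ⟩
  sumSubsets (f ∘ (outside ∷_)) + sumSubsets (f ∘ (inside ∷_))
    ≡⟨ cong₂ _+_ (sumOver-cong (λ S → f≗g (outside ∷ S) λ ()) (allSubsets k))
                 (sumSubsets-update _ _ T λ S S≢T → f≗g _ (S≢T ∘ ∷-injectiveʳ)) ⟩
  sumSubsets (g ∘ (outside ∷_)) + (sumSubsets (g ∘ (inside ∷_)) + d)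
    ≡⟨ sym (ℤP.+-assoc (sumSubsets (g ∘ (outside ∷_))) _ d) ⟩
  (sumSubsets (g ∘ (outside ∷_)) + sumSubsets (g ∘ (inside ∷_))) + d
    ≡⟨ cong (_+ d) (sym (sumSubsets-suc g)) ⟩
  sumSubsets g + d                                             ∎
  where
  open ≡-Reasoning
  d : ℤ
  d = f (inside ∷ T) - g (inside ∷ T)

sumSubsets-update₂ : (f g : Subset k → ℤ) {T T′ : Subset k} → T ≢ T′
                   → (∀ S → S ≢ T → S ≢ T′ → f S ≡ g S)
                   → sumSubsets f ≡ sumSubsets g + (f T - g T) + (f T′ - g T′)
sumSubsets-update₂ {k} f g {T} {T′} T≢T′ f≗g = begin
  sumSubsets f
    ≡⟨ sumSubsets-update f h T′ f≗h ⟩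
  sumSubsets h + (f T′ - h T′)
    ≡⟨ cong₂ (λ a b → a + (f T′ - b)) (sumSubsets-update h g T h-away) (h-away T′ (T≢T′ ∘ sym)) ⟩
  sumSubsets g + (h T - g T) + (f T′ - g T′)
    ≡⟨ cong (λ a → sumSubsets g + (a - g T) + _) h-at ⟩
  sumSubsets g + (f T - g T) + (f T′ - g T′)
    ∎
  where
  open ≡-Reasoning
  h : Subset k → ℤ
  h S with S ≟ˢ T
  ... | yes _ = f S
  ... | no  _ = g S
  h-at : h T ≡ f T
  h-at with T ≟ˢ T
  ... | yes _   = refl
  ... | no  T≢T = contradiction refl T≢T
  h-away : ∀ S → S ≢ T → h S ≡ g S
  h-away S S≢T with S ≟ˢ T
  ... | yes S≡T = contradiction S≡T S≢T
  ... | no  _   = refl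
  f≗h : ∀ S → S ≢ T′ → f S ≡ h S
  f≗h S S≢T′ with S ≟ˢ T
  ... | yes _   = refl
  ... | no  S≢T = f≗g S S≢T S≢T′

module _ {n k} (C : Fin k → Subset n) where

  F[]-⊥ : F[ C ] ⊥ ≡ unionAll C
  F[]-⊥ with ∣ ⊥ {n = k} ∣ | ∣⊥∣≡0 k
  ... | _ | refl = refl

  F[]-nonempty : ∀ {S} → S ≢ ⊥ → F[ C ] S ≡ interOver C S
  F[]-nonempty {S} S≢⊥ with ∣ S ∣ in ∣S∣≡
  ... | zero  = contradiction (∣p∣≡0⇒p≡⊥ ∣S∣≡) S≢⊥
  ... | suc _ = refl

  interOver-⁅⁆ : ∀ j → interOver C ⁅ j ⁆ ≡ C j
  interOver-⁅⁆ j = ⊆-antisym (λ x∈ → ∈-interOver⁻ C ⁅ j ⁆ x∈ (x∈⁅x⁆ j))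
    λ {x} x∈Cj → ∈-interOver⁺ C ⁅ j ⁆ λ i∈⁅j⁆ →
      subst (λ i → x ∈ C i) (sym (x∈⁅y⁆⇒x≡y j i∈⁅j⁆)) x∈Cj

module _ {n} (M : Matroid n) where

  term : ∀ {k} → (Fin k → Subset n) → Subset k → ℤ
  term C S = sign ∣ S ∣ * + r M (F[ C ] S)

  term-⊥ : ∀ {k} (C : Fin k → Subset n) → term C ⊥ ≡ + r M (unionAll C)
  term-⊥ {k} C = trans (cong₂ (λ m X → sign m * + r M X) (∣⊥∣≡0 k) (F[]-⊥ C)) (ℤP.*-identityˡ _)

  term-⁅⁆ : ∀ {k} (C : Fin k → Subset n) j → term C ⁅ j ⁆ ≡ - + r M (C j)
  term-⁅⁆ C j = trans (cong₂ (λ m X → sign m * + r M X) (∣⁅x⁆∣≡1 j)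
                            (trans (F[]-nonempty C (⁅⁆≢⊥ j)) (interOver-⁅⁆ C j)))
                     (ℤP.-1*i≡-i _)

  Δ-update : ∀ {k} (C D : Fin k → Subset n) j
           → (∀ S → S ≢ ⊥ → S ≢ ⁅ j ⁆ → F[ D ] S ≡ F[ C ] S)
           → Δ M D ≡ Δ M C + (+ (r M (unionAll D) ℕ.+ r M (C j)) - + (r M (unionAll C) ℕ.+ r M (D j)))
  Δ-update C D j F[D]≗F[C] = begin
    Δ M D
      ≡⟨ sumSubsets-update₂ (term D) (term C) (⁅⁆≢⊥ j ∘ sym) term-agrees ⟩
    Δ M C + (term D ⊥ - term C ⊥) + (term D ⁅ j ⁆ - term C ⁅ j ⁆)
      ≡⟨ cong₂ (λ a b → Δ M C + a + b) (cong₂ _-_ (term-⊥ D) (term-⊥ C))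
                                       (cong₂ _-_ (term-⁅⁆ D j) (term-⁅⁆ C j)) ⟩
    Δ M C + (+ u′ - + u) + (- + d - - + c)
      ≡⟨ rearrange (Δ M C) (+ u′) (+ u) (+ d) (+ c) ⟩
    Δ M C + ((+ u′ + + c) - (+ u + + d))
      ≡⟨ cong₂ (λ a b → Δ M C + (a - b)) (ℤP.pos-+ u′ c) (ℤP.pos-+ u d) ⟨
    Δ M C + (+ (u′ ℕ.+ c) - + (u ℕ.+ d))
      ∎
    where
    open ≡-Reasoning
    u u′ c d : ℕ
    u  = r M (unionAll C)
    u′ = r M (unionAll D)
    c  = r M (C j)
    d  = r M (D j)
    term-agrees : ∀ S → S ≢ ⊥ → S ≢ ⁅ j ⁆ → term D S ≡ term C S
    term-agrees S S≢⊥ S≢⁅j⁆ = cong (λ X → sign ∣ S ∣ * + r M X) (F[D]≗F[C] S S≢⊥ S≢⁅j⁆)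
    rearrange : ∀ δ u′ u d c → δ + (u′ - u) + (- d - - c) ≡ δ + ((u′ + c) - (u + d))
    rearrange = solve-∀

restrictAt : (Fin k → Subset n) → Fin k → Subset n → Fin k → Subset n
restrictAt C j K = updateAt C j (_∩ K)

module _ {n k} (C : Fin k → Subset n) (j : Fin k) (K : Subset n) where

  restrictAt-⊆ : ∀ i → restrictAt C j K i ⊆ C i
  restrictAt-⊆ = updateAt-elim (λ i X → X ⊆ C i) C j (p∩q⊆p (C j) K) (λ _ _ → id)

  unionExcept⊆unionAll-restrictAt : unionExcept C j ⊆ unionAll (restrictAt C j K)
  unionExcept⊆unionAll-restrictAt {x} x∈ with ∈-unionExcept⁻ C j x∈
  ... | i , i≢j , x∈Ci =
    ∈-unionAll⁺ (restrictAt C j K) (subst (x ∈_) (sym (updateAt-minimal i j C i≢j)) x∈Ci)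

  interOver-restrictAt : unionExcept C j ⊆ K → ∀ {S} → S ≢ ⁅ j ⁆
                       → interOver (restrictAt C j K) S ≡ interOver C S
  interOver-restrictAt U⊆K {S} S≢⁅j⁆ = ⊆-antisym
    (λ x∈ → ∈-interOver⁺ C S λ i∈S → restrictAt-⊆ _ (∈-interOver⁻ _ S x∈ i∈S))
    λ {x} x∈ → ∈-interOver⁺ _ S λ {i} → updateAt-elim (λ i X → i ∈ S → x ∈ X) C j
      (λ j∈S → x∈p∩q⁺ (∈-interOver⁻ C S x∈ j∈S , x∈K x∈ j∈S))
      (λ i _ → ∈-interOver⁻ C S x∈) i
    where
    x∈K : ∀ {x} → x ∈ interOver C S → j ∈ S → x ∈ K
    x∈K x∈ j∈S with ∈∧≢⁅⁆⇒∃≢ j∈S S≢⁅j⁆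
    ... | i , i∈S , i≢j = U⊆K (∈-unionExcept⁺ C j i≢j (∈-interOver⁻ C S x∈ i∈S))

  F[]-restrictAt : unionExcept C j ⊆ K → ∀ S → S ≢ ⊥ → S ≢ ⁅ j ⁆
                 → F[ restrictAt C j K ] S ≡ F[ C ] S
  F[]-restrictAt U⊆K S S≢⊥ S≢⁅j⁆ = begin
    F[ restrictAt C j K ] S          ≡⟨ F[]-nonempty _ S≢⊥ ⟩
    interOver (restrictAt C j K) S   ≡⟨ interOver-restrictAt U⊆K S≢⁅j⁆ ⟩
    interOver C S                    ≡⟨ F[]-nonempty C S≢⊥ ⟨
    F[ C ] S                         ∎
    where open ≡-Reasoning

module Tightening {n} (M : Matroid n) where

  open Closure M

  tighten : (Fin k → Subset n) → Fin k → Fin k → Subset n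
  tighten C j = restrictAt C j (cl (unionExcept C j))

  module _ {k} (C : Fin k → Subset n) (j : Fin k) where

    private
      K : Subset n
      K = cl (unionExcept C j)

    tighten-isFlat : (∀ i → IsFlat M (C i)) → ∀ i → IsFlat M (tighten C j i)
    tighten-isFlat flats =
      updateAt-elim (λ _ → IsFlat M) C j (∩-isFlat (flats j) cl-isFlat) (λ i _ → flats i)

    totalSize-tighten : ¬ (C j ⊆ K) → totalSize (tighten C j) < totalSize C
    totalSize-tighten Cj⊈K with ⊈⇒∃∉ Cj⊈K
    ... | x , x∈Cj , x∉K = totalSize-strict (restrictAt-⊆ C j K)
      (restrictAt-⊆ C j K j , x , x∈Cj , x∉K ∘ p∩q⊆q (C j) K ∘ subst (x ∈_) (updateAt-updates j C))

    rank-tighten : r M (unionAll C) ℕ.+ r M (tighten C j j) ≤ r M (unionAll (tighten C j)) ℕ.+ r M (C j)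
    rank-tighten = begin
      r M (unionAll C) ℕ.+ r M (tighten C j j)
        ≡⟨ cong (λ X → r M (unionAll C) ℕ.+ r M X) (updateAt-updates j C) ⟩
      r M (unionAll C) ℕ.+ r M (C j ∩ K)
        ≤⟨ ℕP.+-mono-≤ (r-mono M (∪-mono ⊆-cl id ∘ unionAll⊆unionExcept∪ C j))
                       (ℕP.≤-reflexive (cong (r M) (∩-comm (C j) K))) ⟩
      r M (K ∪ C j) ℕ.+ r M (K ∩ C j)
        ≤⟨ r-submod M K (C j) ⟩
      r M K ℕ.+ r M (C j)
        ≤⟨ ℕP.+-monoˡ-≤ (r M (C j))
             (ℕP.≤-trans cl-rank (r-mono M (unionExcept⊆unionAll-restrictAt C j K))) ⟩
      r M (unionAll (tighten C j)) ℕ.+ r M (C j)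
        ∎
      where open ℕP.≤-Reasoning

    Δ-tighten : Δ M C ℤ.≤ Δ M (tighten C j)
    Δ-tighten = begin
      Δ M C                    ≡⟨ ℤP.+-identityʳ (Δ M C) ⟨
      Δ M C + + 0              ≤⟨ ℤP.+-monoʳ-≤ (Δ M C) (ℤP.i≤j⇒0≤j-i (ℤ.+≤+ rank-tighten)) ⟩
      Δ M C + (+ gain - + loss) ≡⟨ Δ-update M C (tighten C j) j (F[]-restrictAt C j K ⊆-cl) ⟨
      Δ M (tighten C j)        ∎
      where
      open ℤP.≤-Reasoning
      gain loss : ℕ
      gain = r M (unionAll (tighten C j)) ℕ.+ r M (C j)
      loss = r M (unionAll C) ℕ.+ r M (tighten C j j)

  InClosureOfOthers : (Fin k → Subset n) → Fin k → Set
  InClosureOfOthers C j = Σ (Subset n) λ K → IsClosure M (unionExcept C j) K × C j ⊆ K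

  tightenAll : ∀ {k} b (C : Fin k → Subset n) → (∀ i → IsFlat M (C i)) → totalSize C < b
             → Σ (Fin k → Subset n) λ C′ →
                 (∀ i → IsFlat M (C′ i)) × Δ M C′ ≥ Δ M C × (∀ j → InClosureOfOthers C′ j)
  tightenAll zero C flats ()
  tightenAll (suc b) C flats size<b with all? (λ j → C j ⊆? cl (unionExcept C j))
  ... | yes spanned = C , flats , ℤP.≤-refl , λ j → cl (unionExcept C j) , cl-isClosure , spanned j
  ... | no ¬spanned with ¬∀⟶∃¬ _ _ (λ j → C j ⊆? cl (unionExcept C j)) ¬spanned
  ... | j , Cj⊈cl with tightenAll b (tighten C j) (tighten-isFlat C j flats)
                         (ℕP.<-≤-trans (totalSize-tighten C j Cj⊈cl) (s≤s⁻¹ size<b))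
  ... | C′ , flats′ , Δ≤ , spanned′ = C′ , flats′ , ℤP.≤-trans (Δ-tighten C j) Δ≤ , spanned′

proposition3 : ∀ {n k : ℕ} (M : Matroid n) (C : Fin k → Subset n)
    → (∀ i → IsFlat M (C i)) → 1 < k
    → Σ (Fin k → Subset n) λ C′ →
        (∀ i → IsFlat M (C′ i))
        × Δ M C′ ≥ Δ M C
        × (∀ j → Σ (Subset n) λ cl → IsClosure M (unionExcept C′ j) cl × C′ j ⊆ cl)
proposition3 M C flats _ = tightenAll (suc (totalSize C)) C flats (ℕP.n<1+n (totalSize C))
  where open Tightening M
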